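{- Let $c$ be a positive integer and $n \ge 2$, and define $a_1(c) = 1$, $a_m(c) = a_{m-1}(c)^2 + c^{2^{m-1}-1}$ for $m \ge 2$. Suppose $a_n(c)$ is a square. Then we can write $c = uv$ with coprime integers $u$ and $v$ such that: (1) if $c$ is odd, then $v^{2^{n-1}-1} - u^{2^{n-1}-1} = 2 a_{n-1}(uv)$; (2) if $c$ is even, then $u$ is even and $v^{2^{n-1}-1} - \frac{1}{4} u^{2^{n-1}-1} = a_{n-1}(uv)$. If in addition $b_n(c) = (a_{n-1}(c) + \sqrt{a_n(c)})/2$ (with the positive square root) is a square, then $c$ is even and either $v$ is a square (and $u, v$ are positive) or $-u$ is a square (and $u, v$ are negative). -}

module Defs where

open import Data.Nat as ℕ using (ℕ; zero; suc)
open import Data.Integer using (ℤ; +_; _+_; _*_; _-_; _^_)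
open import Data.Product using (∃-syntax)
open import Relation.Binary.PropositionalEquality using (_≡_)

-- The sequence a_m(c), for m ≥ 1, over the integers (the paper applies it to
-- c = uv, which may be negative):
--   a_1(c) = 1,  a_m(c) = a_{m-1}(c)^2 + c^(2^(m-1) - 1)  for m ≥ 2.
-- The value at index 0 is a dummy (never used).
a : ℕ → ℤ → ℤ
a zero c = + 0
a (suc zero) c = + 1
a (suc (suc k)) c = a (suc k) c ^ 2 + c ^ (2 ℕ.^ (suc k) ℕ.∸ 1)

IsSquare : ℤ → Set
IsSquare x = ∃[ y ] (y * y ≡ x)

module Submission where

-- Write n = m + 2, A = a_{n−1}(c) and N = 2^(n−1) − 1 = 2K + 1, so that a_n(c) = A² + c^N.
-- Since A ≡ 1 (mod c), A is coprime to c.  If S² = A² + c^N then S = A + x with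
-- x(x + 2A) = c^N, and coprime factors of an N-th power are themselves N-th powers.
--  * c odd: x and x + 2A are coprime, so x = u^N, x + 2A = v^N with c = uv; and
--    (A + S)/2 = (x + 2A)/2 is never a square since x + 2A is odd.
--  * c even: x = 2X and c^N = 4XY with Y = X + A coprime to X; the even one of X, Y takes
--    the factor 4.  Y even: X = g^N, 4Y = h^N, (u, v) = (−h, −g).  Y odd: 4X = g^N,
--    Y = h^N, (u, v) = (g, h).  Since (A + S)/2 = Y, b_n(c) is a square exactly when Y is,
--    and then h^N is a square, hence so is h because N is odd.

open import Defs

module Natural where

  open import Data.Nat
  open import Data.Nat.Properties
  open import Data.Nat.Divisibility
  open import Data.Nat.Coprimality using (Coprime; coprime-divisor; coprime-/gcd)
    renaming (sym to coprime-sym)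
  open import Data.Nat.GCD using (gcd; gcd[m,n]∣m; gcd[m,n]∣n; gcd-greatest; gcd[m,n]≢0; c*gcd[m,n]≡gcd[cm,cn])
  open import Data.Nat.DivMod using (_/_; m/n*n≡m)
  open import Data.Nat.Primality using (Prime; prime[2]; ¬prime[1]; euclidsLemma; prime⇒irreducible)
  open import Data.Nat.Tactic.RingSolver using (solve-∀)
  open import Algebra.Properties.CommutativeSemigroup *-commutativeSemigroup
    using () renaming (interchange to *-interchange)
  open import Data.Product using (∃-syntax; _×_; _,_)
  open import Data.Sum using (inj₁; inj₂)
  open import Data.Empty using (⊥-elim)
  open import Relation.Nullary using (¬_; Dec; yes; no)
  open import Relation.Binary.PropositionalEquality
  open import Relation.Binary.Definitions using (tri<; tri≈; tri>)

  private variable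
    c d m n o p w x y A B M S X : ℕ

  Square : ℕ → Set
  Square h = ∃[ r ] r * r ≡ h

  ^-distribʳ-* : ∀ m n k → (m * n) ^ k ≡ m ^ k * n ^ k
  ^-distribʳ-* m n zero    = refl
  ^-distribʳ-* m n (suc k) = begin
    m * n * (m * n) ^ k       ≡⟨ cong (m * n *_) (^-distribʳ-* m n k) ⟩
    m * n * (m ^ k * n ^ k)   ≡⟨ *-interchange m n (m ^ k) (n ^ k) ⟩
    m * m ^ k * (n * n ^ k)   ∎
    where open ≡-Reasoning

  coprime-∣ˡ : d ∣ m → Coprime m n → Coprime d n
  coprime-∣ˡ d∣m m⊥n (e∣d , e∣n) = m⊥n (∣-trans e∣d d∣m , e∣n)

  coprime-*ˡ : Coprime m n → Coprime o n → Coprime (m * o) n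
  coprime-*ˡ {m} {n} {o} m⊥n o⊥n {d} (d∣mo , d∣n) = o⊥n (coprime-divisor d⊥m d∣mo , d∣n)
    where
    d⊥m : Coprime d m
    d⊥m (e∣d , e∣m) = m⊥n (e∣m , ∣-trans e∣d d∣n)

  coprime-^ˡ : ∀ k → Coprime m n → Coprime (m ^ k) n
  coprime-^ˡ zero    _   (d∣1 , _) = ∣1⇒≡1 d∣1
  coprime-^ˡ (suc k) m⊥n = coprime-*ˡ m⊥n (coprime-^ˡ k m⊥n)

  coprime-*-∣ : Coprime m n → m ∣ o → n ∣ o → m * n ∣ o
  coprime-*-∣ {m} {n} m⊥n (divides k refl) n∣km
    with coprime-divisor (coprime-sym m⊥n) (subst (n ∣_) (*-comm k m) n∣km)
  ... | divides j refl = divides j (trans (*-assoc j n m) (cong (j *_) (*-comm n m)))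

  coprime-shift : Coprime B M → x ∣ M → Coprime x (x + B)
  coprime-shift B⊥M x∣M (d∣x , d∣x+B) = B⊥M (∣m+n∣m⇒∣n d∣x+B d∣x , ∣-trans d∣x x∣M)

  -- If c ∣ mn then c ∣ m·gcd(n, c), because m·gcd(n, c) = gcd(mn, mc).
  ∣-*-gcd : ∀ m n → c ∣ m * n → c ∣ m * gcd n c
  ∣-*-gcd {c} m n c∣mn =
    subst (c ∣_) (sym (c*gcd[m,n]≡gcd[cm,cn] m n c)) (gcd-greatest c∣mn (n∣m*n m))

  ∣-∣-product⇒≡ : .{{NonZero (m * n)}} → m ∣ x → n ∣ y → x * y ≡ m * n → x ≡ m × y ≡ n
  ∣-∣-product⇒≡ {m} {n} (divides k refl) (divides l refl) kmln≡mn =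
    cancel k m (m*n≡1⇒m≡1 k l kl≡1) , cancel l n (m*n≡1⇒n≡1 k l kl≡1)
    where
    kl≡1 : k * l ≡ 1
    kl≡1 = *-cancelʳ-≡ (k * l) 1 (m * n)
      (trans (sym (*-interchange k m l n)) (trans kmln≡mn (sym (*-identityˡ (m * n)))))
    cancel : ∀ q r → q ≡ 1 → q * r ≡ r
    cancel q r refl = *-identityˡ r

  PowerSplitting : ℕ → ℕ → ℕ → ℕ → Set
  PowerSplitting N c x y = ∃[ g ] ∃[ h ] (Coprime g h × c ≡ g * h × x ≡ g ^ N × y ≡ h ^ N)

  -- Coprime factors of a (k+1)-th power are (k+1)-th powers: if xy = c^(k+1) with x, y
  -- coprime, then x = g^(k+1), y = h^(k+1) for g = gcd(x, c), h = gcd(y, c), and c = gh.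
  coprime-power-factors : ∀ k .{{_ : NonZero c}} → Coprime x y → x * y ≡ c ^ suc k →
    PowerSplitting (suc k) c x y
  coprime-power-factors {c} {x} {y} k x⊥y xy≡cᴺ =
    g , h , g⊥h , c≡gh , ∣-∣-product⇒≡ {{gᴺhᴺ≢0}} gᴺ∣x hᴺ∣y xy≡gᴺhᴺ
    where
    N : ℕ
    N = suc k
    g h : ℕ
    g = gcd x c
    h = gcd y c
    g⊥h : Coprime g h
    g⊥h = coprime-∣ˡ (gcd[m,n]∣m x c) (coprime-sym (coprime-∣ˡ (gcd[m,n]∣m y c) (coprime-sym x⊥y)))
    -- c ∣ xy gives c ∣ x·h and then c ∣ h·g; conversely g and h are coprime divisors of c.
    c≡gh : c ≡ g * h
    c≡gh = ∣-antisym c∣gh (coprime-*-∣ g⊥h (gcd[m,n]∣n x c) (gcd[m,n]∣n y c))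
      where
      c∣xh : c ∣ x * h
      c∣xh = ∣-*-gcd x y (subst (c ∣_) (sym xy≡cᴺ) (m∣m*n (c ^ k)))
      c∣gh : c ∣ g * h
      c∣gh = subst (c ∣_) (*-comm h g) (∣-*-gcd h x (subst (c ∣_) (*-comm x h) c∣xh))
    xy≡gᴺhᴺ : x * y ≡ g ^ N * h ^ N
    xy≡gᴺhᴺ = trans xy≡cᴺ (trans (cong (_^ N) c≡gh) (^-distribʳ-* g h N))
    gᴺhᴺ≢0 : NonZero (g ^ N * h ^ N)
    gᴺhᴺ≢0 = subst NonZero (trans (sym xy≡cᴺ) xy≡gᴺhᴺ) (m^n≢0 c N)
    gᴺ∣x : g ^ N ∣ x
    gᴺ∣x = coprime-divisor (coprime-^ˡ N (coprime-∣ˡ (gcd[m,n]∣m x c) x⊥y))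
      (subst (g ^ N ∣_) (trans (sym xy≡gᴺhᴺ) (*-comm x y)) (m∣m*n (h ^ N)))
    hᴺ∣y : h ^ N ∣ y
    hᴺ∣y = coprime-divisor (coprime-^ˡ N (coprime-∣ˡ (gcd[m,n]∣m y c) (coprime-sym x⊥y)))
      (subst (h ^ N ∣_) (sym xy≡gᴺhᴺ) (n∣m*n (g ^ N)))

  -- w² ∣ m² implies w ∣ m.  With g = gcd(w, m), w = w′·g and m = m′·g for coprime w′, m′;
  -- cancelling g² gives w′² ∣ m′², so w′ ∣ m′·m′, hence w′ ∣ m′, hence w′ = 1 and w = g ∣ m.
  square-∣-square : .{{NonZero w}} → w * w ∣ m * m → w ∣ m
  square-∣-square {w} {m} ww∣mm = subst (_∣ m) g≡w (gcd[m,n]∣n w m)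
    where
    g : ℕ
    g = gcd w m
    instance
      g≢0 : NonZero g
      g≢0 = ≢-nonZero (gcd[m,n]≢0 w m (inj₁ (≢-nonZero⁻¹ w)))
      gg≢0 : NonZero (g * g)
      gg≢0 = m*n≢0 g g
    w′ m′ : ℕ
    w′ = w / g
    m′ = m / g
    w′g≡w : w′ * g ≡ w
    w′g≡w = m/n*n≡m (gcd[m,n]∣m w m)
    m′g≡m : m′ * g ≡ m
    m′g≡m = m/n*n≡m (gcd[m,n]∣n w m)
    scaled-square : ∀ q r → q * g ≡ r → r * r ≡ q * q * (g * g)
    scaled-square q r refl = *-interchange q g q g
    w′²∣m′² : w′ * w′ ∣ m′ * m′
    w′²∣m′² = *-cancelʳ-∣ (g * g)
      (subst₂ _∣_ (scaled-square w′ w w′g≡w) (scaled-square m′ m m′g≡m) ww∣mm)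
    w′∣m′ : w′ ∣ m′
    w′∣m′ = coprime-divisor (coprime-/gcd w m) (∣-trans (m∣m*n w′) w′²∣m′²)
    w′≡1 : w′ ≡ 1
    w′≡1 = coprime-/gcd w m (∣-refl , w′∣m′)
    g≡w : g ≡ w
    g≡w = trans (sym (*-identityˡ g)) (trans (cong (_* g) (sym w′≡1)) w′g≡w)

  square-injective : ∀ m n → m * m ≡ n * n → m ≡ n
  square-injective m n mm≡nn with <-cmp m n
  ... | tri< m<n _ _ = ⊥-elim (<-irrefl mm≡nn (*-mono-< m<n m<n))
  ... | tri≈ _ m≡n _ = m≡n
  ... | tri> _ _ n<m = ⊥-elim (<-irrefl (sym mm≡nn) (*-mono-< n<m n<m))

  square-* : Square m → Square n → Square (m * n)
  square-* (r , refl) (s , refl) = r * s , *-interchange r s r s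

  -- If an odd power h^(2K+1) is a square then so is h: writing t² = h·(h^K)², the
  -- divisibility (h^K)² ∣ t² gives t = r·h^K and then h = r².
  odd-power-square : ∀ {h} K → Square (h ^ suc (K + K)) → Square h
  odd-power-square {zero}      K _ = 0 , refl
  odd-power-square {h@(suc _)} K (t , tt≡hᴺ) = root (square-∣-square {{Wᵢ≢0}} (divides h tt≡h·WW))
    where
    W : ℕ
    W = h ^ K
    Wᵢ≢0 : NonZero W
    Wᵢ≢0 = m^n≢0 h K
    tt≡h·WW : t * t ≡ h * (W * W)
    tt≡h·WW = trans tt≡hᴺ (cong (h *_) (^-distribˡ-+-* h K K))
    root : W ∣ t → Square h
    root (divides r refl) = r , *-cancelʳ-≡ (r * r) h (W * W) {{m*n≢0 W W {{Wᵢ≢0}} {{Wᵢ≢0}}}}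
      (trans (sym (*-interchange r W r W)) tt≡h·WW)

  prime-∣-^ : Prime p → ∀ k → p ∣ m ^ k → p ∣ m
  prime-∣-^ pr zero    p∣1 = ⊥-elim (¬prime[1] (subst Prime (∣1⇒≡1 p∣1) pr))
  prime-∣-^ {m = m} pr (suc k) p∣mᵏ⁺¹ with euclidsLemma m (m ^ k) pr p∣mᵏ⁺¹
  ... | inj₁ p∣m  = p∣m
  ... | inj₂ p∣mᵏ = prime-∣-^ pr k p∣mᵏ

  prime-∤⇒coprime : Prime p → ¬ p ∣ m → Coprime p m
  prime-∤⇒coprime pr p∤m (d∣p , d∣m) with prime⇒irreducible pr d∣p
  ... | inj₁ d≡1 = d≡1
  ... | inj₂ refl = ⊥-elim (p∤m d∣m)

  coprime⇒¬both-even : Coprime m n → 2 ∣ m → ¬ 2 ∣ n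
  coprime⇒¬both-even m⊥n 2∣m 2∣n with () ← m⊥n (2∣m , 2∣n)

  -- (A + S)/2 is a square; for A = a_{n-1}(c) and S = √a_n(c) this says b_n(c) is a square.
  HalfSumSquare : ℕ → ℕ → Set
  HalfSumSquare A S = ∃[ t ] A + S ≡ 2 * (t * t)

  -- In the even-negative case the integers of the lemma are −u and −v.
  data Factorisation (c N A S : ℕ) : Set where
    odd           : ∀ u v → ¬ 2 ∣ c → Coprime u v → c ≡ u * v →
                    v ^ N ≡ u ^ N + 2 * A → ¬ HalfSumSquare A S → Factorisation c N A S
    even-positive : ∀ u v → 2 ∣ c → Coprime u v → c ≡ u * v → 2 ∣ u →
                    4 * v ^ N ≡ u ^ N + 4 * A → (HalfSumSquare A S → Square v) → Factorisation c N A S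
    even-negative : ∀ u v → 2 ∣ c → Coprime u v → c ≡ u * v → 2 ∣ u →
                    u ^ N ≡ 4 * v ^ N + 4 * A → (HalfSumSquare A S → Square u) → Factorisation c N A S

  square-gap : S * S ≡ A * A + M → ∃[ x ] (S ≡ A + x × x * (x + 2 * A) ≡ M)
  square-gap {S} {A} {M} SS≡ = gap (m≤n⇒∃[o]m+o≡n A≤S)
    where
    A≤S : A ≤ S
    A≤S = ≮⇒≥ λ S<A → <⇒≱ (*-mono-< S<A S<A) (≤-trans (m≤m+n (A * A) M) (≤-reflexive (sym SS≡)))
    completed-square : ∀ A x → A * A + x * (x + 2 * A) ≡ (A + x) * (A + x)
    completed-square = solve-∀
    gap : ∃[ x ] A + x ≡ S → ∃[ x ] (S ≡ A + x × x * (x + 2 * A) ≡ M)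
    gap (x , A+x≡S) = x , sym A+x≡S , +-cancelˡ-≡ (A * A) _ _
      (trans (completed-square A x) (trans (cong (λ z → z * z) A+x≡S) SS≡))

  -- The factors x and x + 2A of c^N are coprime (2A is coprime to c^N), so they
  -- are N-th powers u^N and v^N with c = uv; and (A + S)/2 = (x + 2A)/2 is no square since
  -- x + 2A divides the odd number c^N.
  odd-case : ∀ k .{{_ : NonZero c}} → Coprime A c → ¬ 2 ∣ c → x * (x + 2 * A) ≡ c ^ suc k →
    Factorisation c (suc k) A (A + x)
  odd-case {c} {A} {x} k A⊥c 2∤c gap = build (coprime-power-factors k x⊥x+2A gap)
    where
    N : ℕ
    N = suc k
    2∤cᴺ : ¬ 2 ∣ c ^ N
    2∤cᴺ 2∣cᴺ = 2∤c (prime-∣-^ prime[2] N 2∣cᴺ)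
    2A⊥cᴺ : Coprime (2 * A) (c ^ N)
    2A⊥cᴺ = coprime-*ˡ (prime-∤⇒coprime prime[2] 2∤cᴺ) (coprime-sym (coprime-^ˡ N (coprime-sym A⊥c)))
    x⊥x+2A : Coprime x (x + 2 * A)
    x⊥x+2A = coprime-shift 2A⊥cᴺ (divides (x + 2 * A) (trans (sym gap) (*-comm x _)))
    rearrange : ∀ A x → x + 2 * A ≡ A + (A + x)
    rearrange = solve-∀
    ¬half : ¬ HalfSumSquare A (A + x)
    ¬half (t , A+S≡2tt) = 2∤cᴺ (∣-trans 2∣x+2A (divides x (sym gap)))
      where
      2∣x+2A : 2 ∣ x + 2 * A
      2∣x+2A = divides (t * t) (trans (rearrange A x) (trans A+S≡2tt (*-comm 2 (t * t))))
    build : PowerSplitting N c x (x + 2 * A) → Factorisation c N A (A + x)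
    build (u , v , u⊥v , c≡uv , x≡uᴺ , y≡vᴺ) =
      odd u v 2∤c u⊥v c≡uv (trans (sym y≡vᴺ) (cong (_+ 2 * A) x≡uᴺ)) ¬half

  -- If x(x + 2A) is even then so is x, since x and x + 2A have the same parity.
  even-first-factor : ∀ A → 2 ∣ x * (x + 2 * A) → 2 ∣ x
  even-first-factor {x} A 2∣product with euclidsLemma x (x + 2 * A) prime[2] 2∣product
  ... | inj₁ 2∣x     = 2∣x
  ... | inj₂ 2∣x+2A = ∣m+n∣m⇒∣n (subst (2 ∣_) (+-comm x (2 * A)) 2∣x+2A) (m∣m*n A)

  half-sum-square : HalfSumSquare A (A + X * 2) → Square (X + A)
  half-sum-square {A} {X} (t , A+S≡2tt) =
    t , sym (*-cancelˡ-≡ (X + A) (t * t) 2 (trans (rearrange A X) A+S≡2tt))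
    where
    rearrange : ∀ A X → 2 * (X + A) ≡ A + (A + X * 2)
    rearrange = solve-∀

  -- c even, c^N = X·4Y with Y = X + A even.  Then X is odd, so X and 4Y are coprime
  -- N-th powers g^N and h^N; take (u, v) = (h, g), where h is even and h^N = 4Y is a
  -- square when Y is.
  even-Y-case : ∀ K .{{_ : NonZero c}} → 2 ∣ c → Coprime X (X + A) → 2 ∣ X + A →
    X * (4 * (X + A)) ≡ c ^ suc (K + K) → Factorisation c (suc (K + K)) A (A + X * 2)
  even-Y-case {c} {X} {A} K 2∣c X⊥Y 2∣Y X·4Y≡cᴺ = build (coprime-power-factors (K + K) X⊥4Y X·4Y≡cᴺ)
    where
    N Y : ℕ
    N = suc (K + K)
    Y = X + A
    2⊥X : Coprime 2 X
    2⊥X = prime-∤⇒coprime prime[2] (coprime⇒¬both-even (coprime-sym X⊥Y) 2∣Y)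
    X⊥4Y : Coprime X (4 * Y)
    X⊥4Y = coprime-sym (coprime-*ˡ (coprime-*ˡ 2⊥X 2⊥X) (coprime-sym X⊥Y))
    build : PowerSplitting N c X (4 * Y) → Factorisation c N A (A + X * 2)
    build (g , h , g⊥h , c≡gh , X≡gᴺ , 4Y≡hᴺ) =
      even-negative h g 2∣c (coprime-sym g⊥h) (trans c≡gh (*-comm g h)) 2∣h hᴺ≡4gᴺ+4A square-h
      where
      2∣h : 2 ∣ h
      2∣h = prime-∣-^ prime[2] N (subst (2 ∣_) 4Y≡hᴺ (∣m⇒∣m*n Y (divides 2 refl)))
      hᴺ≡4gᴺ+4A : h ^ N ≡ 4 * g ^ N + 4 * A
      hᴺ≡4gᴺ+4A = trans (sym 4Y≡hᴺ) (trans (*-distribˡ-+ 4 X A) (cong (λ z → 4 * z + 4 * A) X≡gᴺ))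
      square-h : HalfSumSquare A (A + X * 2) → Square h
      square-h half = odd-power-square K (subst Square 4Y≡hᴺ (square-* (2 , refl) (half-sum-square {A} {X} half)))

  -- c even, c^N = 4X·Y with Y = X + A odd.  Then 4X and Y are coprime N-th powers g^N and
  -- h^N; take (u, v) = (g, h), where g is even and h^N = Y is a square when Y is.
  odd-Y-case : ∀ K .{{_ : NonZero c}} → 2 ∣ c → Coprime X (X + A) → ¬ 2 ∣ X + A →
    4 * X * (X + A) ≡ c ^ suc (K + K) → Factorisation c (suc (K + K)) A (A + X * 2)
  odd-Y-case {c} {X} {A} K 2∣c X⊥Y 2∤Y 4X·Y≡cᴺ = build (coprime-power-factors (K + K) 4X⊥Y 4X·Y≡cᴺ)
    where
    N Y : ℕ
    N = suc (K + K)
    Y = X + A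
    2⊥Y : Coprime 2 Y
    2⊥Y = prime-∤⇒coprime prime[2] 2∤Y
    4X⊥Y : Coprime (4 * X) Y
    4X⊥Y = coprime-*ˡ (coprime-*ˡ 2⊥Y 2⊥Y) X⊥Y
    build : PowerSplitting N c (4 * X) Y → Factorisation c N A (A + X * 2)
    build (g , h , g⊥h , c≡gh , 4X≡gᴺ , Y≡hᴺ) = even-positive g h 2∣c g⊥h c≡gh 2∣g 4hᴺ≡gᴺ+4A square-h
      where
      2∣g : 2 ∣ g
      2∣g = prime-∣-^ prime[2] N (subst (2 ∣_) 4X≡gᴺ (∣m⇒∣m*n X (divides 2 refl)))
      4hᴺ≡gᴺ+4A : 4 * h ^ N ≡ g ^ N + 4 * A
      4hᴺ≡gᴺ+4A = trans (cong (4 *_) (sym Y≡hᴺ)) (trans (*-distribˡ-+ 4 X A) (cong (_+ 4 * A) 4X≡gᴺ))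
      square-h : HalfSumSquare A (A + X * 2) → Square h
      square-h half = odd-power-square K (subst Square Y≡hᴺ (half-sum-square {A} {X} half))

  -- Then x = 2X is even (x and x + 2A have the same parity, and x(x + 2A) = c^N),
  -- and c^N = 4XY with Y = X + A coprime to X, as A is coprime to c^N; the parity of Y
  -- decides between the two even cases.
  even-case : ∀ K .{{_ : NonZero c}} → Coprime A c → 2 ∣ c → x * (x + 2 * A) ≡ c ^ suc (K + K) →
    Factorisation c (suc (K + K)) A (A + x)
  even-case {c} {A} {x} K A⊥c 2∣c gap
    with even-first-factor {x} A (subst (2 ∣_) (sym gap) (∣m⇒∣m*n (c ^ (K + K)) 2∣c))
  ... | divides X refl = by-parity (2 ∣? Y)
    where
    N Y : ℕ
    N = suc (K + K)
    Y = X + A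
    X·4Y≡x·[x+2A] : ∀ X A → X * (4 * (X + A)) ≡ X * 2 * (X * 2 + 2 * A)
    X·4Y≡x·[x+2A] = solve-∀
    4X·Y≡x·[x+2A] : ∀ X A → 4 * X * (X + A) ≡ X * 2 * (X * 2 + 2 * A)
    4X·Y≡x·[x+2A] = solve-∀
    X·4Y≡cᴺ : X * (4 * Y) ≡ c ^ N
    X·4Y≡cᴺ = trans (X·4Y≡x·[x+2A] X A) gap
    X⊥Y : Coprime X Y
    X⊥Y = coprime-shift (coprime-sym (coprime-^ˡ N (coprime-sym A⊥c)))
      (divides (4 * Y) (trans (sym X·4Y≡cᴺ) (*-comm X (4 * Y))))
    by-parity : Dec (2 ∣ Y) → Factorisation c N A (A + X * 2)
    by-parity (yes 2∣Y) = even-Y-case K 2∣c X⊥Y 2∣Y X·4Y≡cᴺ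
    by-parity (no 2∤Y)  = odd-Y-case K 2∣c X⊥Y 2∤Y (trans (4X·Y≡x·[x+2A] X A) gap)

  factorise : ∀ K .{{_ : NonZero c}} → Coprime A c → S * S ≡ A * A + c ^ suc (K + K) →
    Factorisation c (suc (K + K)) A S
  factorise {c} {A} {S} K A⊥c SS≡ with square-gap {S} {A} SS≡ | 2 ∣? c
  ... | x , refl , gap | no 2∤c  = odd-case (K + K) A⊥c 2∤c gap
  ... | x , refl , gap | yes 2∣c = even-case K A⊥c 2∣c gap

  -- The exponent 2^(m+1) − 1 = 2·(2^m − 1) + 1 of the recursion is odd.
  odd-exponent : ∀ m → ∃[ K ] 2 ^ suc m ∸ 1 ≡ suc (K + K)
  odd-exponent m with 2 ^ m | m^n>0 2 m
  ... | suc j | _ = j , trans (+-suc j (j + 0)) (cong (λ i → suc (j + i)) (+-identityʳ j))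

  aℕ : ℕ → ℕ → ℕ
  aℕ zero          c = 0
  aℕ (suc zero)    c = 1
  aℕ (suc (suc k)) c = aℕ (suc k) c ^ 2 + c ^ (2 ^ suc k ∸ 1)

  -- a_m(c) ≡ 1 (mod c) for m ≥ 1, since every added term c^(2^k − 1) is a multiple of c.
  aℕ-mod : ∀ k c → ∃[ q ] aℕ (suc k) c ≡ 1 + c * q
  aℕ-mod zero    c = 0 , cong suc (sym (*-zeroʳ c))
  aℕ-mod (suc k) c with aℕ-mod k c | odd-exponent k
  ... | q , aₖ≡1+cq | K , 2^[k+1]∸1≡N = 2 * q + c * q * q + c ^ (K + K) , (begin
    aℕ (suc k) c ^ 2 + c ^ (2 ^ suc k ∸ 1)  ≡⟨ cong₂ (λ a e → a ^ 2 + c ^ e) aₖ≡1+cq 2^[k+1]∸1≡N ⟩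
    (1 + c * q) ^ 2 + c * c ^ (K + K)       ≡⟨ expand c q (c ^ (K + K)) ⟩
    1 + c * (2 * q + c * q * q + c ^ (K + K)) ∎)
    where
    open ≡-Reasoning
    -- stated with x ^ 2 unfolded to x * (x * 1), which the solver can read
    expand : ∀ c q r → (1 + c * q) * ((1 + c * q) * 1) + c * r ≡ 1 + c * (2 * q + c * q * q + r)
    expand = solve-∀

  aℕ-coprime : ∀ k c → Coprime (aℕ (suc k) c) c
  aℕ-coprime k c (d∣a , d∣c) with aℕ-mod k c
  ... | q , a≡1+cq = ∣1⇒≡1 (∣m+n∣m⇒∣n (subst (_ ∣_) (trans a≡1+cq (+-comm 1 (c * q))) d∣a) (∣m⇒∣m*n q d∣c))

open Natural
  using (Square; HalfSumSquare; Factorisation; odd; even-positive; even-negative; factorise;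
         square-injective; odd-exponent; aℕ; aℕ-coprime)
open import Data.Nat as ℕ using (ℕ; zero; suc; NonZero)
import Data.Nat.Properties as ℕ
import Data.Nat.Coprimality as ℕ using (Coprime)
import Data.Nat.Divisibility as ℕ using (_∣_)
open import Data.Integer using (ℤ; +_; -[1+_]; _+_; _*_; _-_; -_; _^_; _≤_; _<_; ∣_∣; +≤+; +<+)
import Data.Integer.Properties as ℤ
open import Data.Integer.Tactic.RingSolver using (solve-∀)
open import Data.Integer.Divisibility using (_∣_)
open import Data.Integer.Coprimality using (Coprime)
open import Data.Product using (_×_; ∃-syntax; _,_; proj₁; proj₂)
open import Data.Sum using (_⊎_; inj₁; inj₂)
open import Data.Empty using (⊥-elim)
open import Relation.Nullary using (¬_)
open import Relation.Binary.PropositionalEquality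

pos-^ : ∀ m k → (+ m) ^ k ≡ + (m ℕ.^ k)
pos-^ m zero    = refl
pos-^ m (suc k) = trans (cong (+ m *_) (pos-^ m k)) (sym (ℤ.pos-* m (m ℕ.^ k)))

neg-^-odd : ∀ i K → (- i) ^ suc (K ℕ.+ K) ≡ - (i ^ suc (K ℕ.+ K))
neg-^-odd i zero    = sign-out i
  where
  sign-out : ∀ i → - i * + 1 ≡ - (i * + 1)
  sign-out = solve-∀
neg-^-odd i (suc K) rewrite ℕ.+-suc K K | neg-^-odd i K = two-signs-out i (i ^ suc (K ℕ.+ K))
  where
  two-signs-out : ∀ i p → - i * (- i * - p) ≡ - (i * (i * p))
  two-signs-out = solve-∀

pos-minus : ∀ {m} n {k} → m ≡ n ℕ.+ k → + m - + n ≡ + k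
pos-minus n {k} refl =
  trans (ℤ.m-n≡m⊖n (n ℕ.+ k) n) (trans (ℤ.⊖-≥ (ℕ.m≤m+n n k)) (cong +_ (ℕ.m+n∸m≡n n k)))

square-abs : ∀ s → s * s ≡ + (∣ s ∣ ℕ.* ∣ s ∣)
square-abs (+ k)    = sym (ℤ.pos-* k k)
square-abs -[1+ k ] = refl

square-pos : ∀ {m} → Square m → IsSquare (+ m)
square-pos (r , rr≡m) = + r , trans (sym (ℤ.pos-* r r)) (cong +_ rr≡m)

positive-factors : ∀ {c} u v → NonZero c → c ≡ u ℕ.* v → + 0 < + u × + 0 < + v
positive-factors u v c≢0 refl =
  +<+ (ℕ.>-nonZero⁻¹ u {{ℕ.m*n≢0⇒m≢0 u {{c≢0}}}}) , +<+ (ℕ.>-nonZero⁻¹ v {{ℕ.m*n≢0⇒n≢0 u {{c≢0}}}})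

a-pos : ∀ m c → a m (+ c) ≡ + aℕ m c
a-pos zero          c = refl
a-pos (suc zero)    c = refl
a-pos (suc (suc k)) c = cong₂ _+_
  (trans (cong (_^ 2) (a-pos (suc k) c)) (pos-^ (aℕ (suc k) c) 2))
  (pos-^ c (2 ℕ.^ suc k ℕ.∸ 1))

Conclusion : ℕ → ℕ → ℕ → Set
Conclusion c m N = ∃[ u ] ∃[ v ] (Coprime u v × + c ≡ u * v
  × (¬ (+ 2 ∣ + c) → v ^ N - u ^ N ≡ + 2 * a (suc m) (u * v))
  × (+ 2 ∣ + c → (+ 2 ∣ u) × (+ 4 * v ^ N - u ^ N ≡ + 4 * a (suc m) (u * v)))
  × ((s : ℤ) → + 0 ≤ s → s * s ≡ a (suc (suc m)) (+ c) → (∃[ t ] (a (suc m) (+ c) + s ≡ + 2 * (t * t))) →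
    (+ 2 ∣ + c) × ((IsSquare v × + 0 < u × + 0 < v) ⊎ (IsSquare (- u) × u < + 0 × v < + 0))))

half-sum-descends : ∀ c m {A S} → a (suc m) (+ c) ≡ + A → a (suc (suc m)) (+ c) ≡ + (S ℕ.* S) →
  (s : ℤ) → + 0 ≤ s → s * s ≡ a (suc (suc m)) (+ c) → ∃[ t ] (a (suc m) (+ c) + s ≡ + 2 * (t * t)) →
  HalfSumSquare A S
half-sum-descends c m {A} {S} aₘ≡A aₙ≡SS (+ k) (+≤+ _) kk≡aₙ (t , aₘ+k≡2tt) = ∣ t ∣ , (begin
  A ℕ.+ S                 ≡⟨ cong (A ℕ.+_) k≡S ⟨
  A ℕ.+ k                 ≡⟨ cong ∣_∣ (trans (ℤ.pos-+ A k) (trans (cong (_+ + k) (sym aₘ≡A)) aₘ+k≡2tt)) ⟩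
  ∣ + 2 * (t * t) ∣       ≡⟨ ℤ.abs-* (+ 2) (t * t) ⟩
  2 ℕ.* ∣ t * t ∣         ≡⟨ cong (2 ℕ.*_) (ℤ.abs-* t t) ⟩
  2 ℕ.* (∣ t ∣ ℕ.* ∣ t ∣) ∎)
  where
  open ≡-Reasoning
  k≡S : k ≡ S
  k≡S = square-injective k S (ℤ.+-injective (trans (ℤ.pos-* k k) (trans kk≡aₙ aₙ≡SS)))

pos-factors : ∀ {c} u v → c ≡ u ℕ.* v → + c ≡ + u * + v
pos-factors u v c≡uv = trans (cong +_ c≡uv) (ℤ.pos-* u v)

a-at-factors : ∀ m (u v : ℤ) {c A} → + c ≡ u * v → a m (+ c) ≡ + A → + A ≡ a m (u * v)
a-at-factors m u v c≡uv aₘ≡A = trans (sym aₘ≡A) (cong (a m) c≡uv)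

conclude : ∀ K {c m A S} → NonZero c → a (suc m) (+ c) ≡ + A → a (suc (suc m)) (+ c) ≡ + (S ℕ.* S) →
  Factorisation c (suc (K ℕ.+ K)) A S → Conclusion c m (suc (K ℕ.+ K))
conclude K {c} {m} {A} c≢0 aₘ≡A aₙ≡SS (odd u v 2∤c u⊥v c≡uv vᴺ≡uᴺ+2A ¬half) =
  + u , + v , u⊥v , c≡+u+v , (λ _ → difference) , (λ 2∣c → ⊥-elim (2∤c 2∣c)) ,
  λ s 0≤s ss≡aₙ half → ⊥-elim (¬half (half-sum-descends c m aₘ≡A aₙ≡SS s 0≤s ss≡aₙ half))
  where
  open ≡-Reasoning
  N : ℕ
  N = suc (K ℕ.+ K)
  c≡+u+v : + c ≡ + u * + v
  c≡+u+v = pos-factors u v c≡uv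
  difference : (+ v) ^ N - (+ u) ^ N ≡ + 2 * a (suc m) (+ u * + v)
  difference = begin
    (+ v) ^ N - (+ u) ^ N        ≡⟨ cong₂ _-_ (pos-^ v N) (pos-^ u N) ⟩
    + (v ℕ.^ N) - + (u ℕ.^ N)    ≡⟨ pos-minus (u ℕ.^ N) vᴺ≡uᴺ+2A ⟩
    + (2 ℕ.* A)                  ≡⟨ ℤ.pos-* 2 A ⟩
    + 2 * + A                    ≡⟨ cong (+ 2 *_) (a-at-factors (suc m) (+ u) (+ v) c≡+u+v aₘ≡A) ⟩
    + 2 * a (suc m) (+ u * + v)  ∎
conclude K {c} {m} {A} c≢0 aₘ≡A aₙ≡SS (even-positive u v 2∣c u⊥v c≡uv 2∣u 4vᴺ≡uᴺ+4A square-v) =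
  + u , + v , u⊥v , c≡+u+v , (λ 2∤c → ⊥-elim (2∤c 2∣c)) , (λ _ → 2∣u , difference) ,
  λ s 0≤s ss≡aₙ half → 2∣c ,
    inj₁ (square-pos (square-v (half-sum-descends c m aₘ≡A aₙ≡SS s 0≤s ss≡aₙ half)) , positive-factors u v c≢0 c≡uv)
  where
  open ≡-Reasoning
  N : ℕ
  N = suc (K ℕ.+ K)
  c≡+u+v : + c ≡ + u * + v
  c≡+u+v = pos-factors u v c≡uv
  difference : + 4 * (+ v) ^ N - (+ u) ^ N ≡ + 4 * a (suc m) (+ u * + v)
  difference = begin
    + 4 * (+ v) ^ N - (+ u) ^ N      ≡⟨ cong₂ (λ p q → + 4 * p - q) (pos-^ v N) (pos-^ u N) ⟩
    + 4 * + (v ℕ.^ N) - + (u ℕ.^ N)  ≡⟨ cong (_- + (u ℕ.^ N)) (ℤ.pos-* 4 (v ℕ.^ N)) ⟨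
    + (4 ℕ.* v ℕ.^ N) - + (u ℕ.^ N)  ≡⟨ pos-minus (u ℕ.^ N) 4vᴺ≡uᴺ+4A ⟩
    + (4 ℕ.* A)                      ≡⟨ ℤ.pos-* 4 A ⟩
    + 4 * + A                        ≡⟨ cong (+ 4 *_) (a-at-factors (suc m) (+ u) (+ v) c≡+u+v aₘ≡A) ⟩
    + 4 * a (suc m) (+ u * + v)      ∎
conclude K {c} {m} {A} {S} c≢0 aₘ≡A aₙ≡SS (even-negative u v 2∣c u⊥v c≡uv 2∣u uᴺ≡4vᴺ+4A square-u) =
  - + u , - + v , -u⊥-v , c≡-u*-v , (λ 2∤c → ⊥-elim (2∤c 2∣c)) , (λ _ → 2∣-u , difference) ,
  λ s 0≤s ss≡aₙ half → 2∣c , inj₂ (square-u′ (half-sum-descends c m aₘ≡A aₙ≡SS s 0≤s ss≡aₙ half) ,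
    ℤ.neg-mono-< (proj₁ (positive-factors u v c≢0 c≡uv)) , ℤ.neg-mono-< (proj₂ (positive-factors u v c≢0 c≡uv)))
  where
  open ≡-Reasoning
  N : ℕ
  N = suc (K ℕ.+ K)
  -u⊥-v : Coprime (- + u) (- + v)
  -u⊥-v = subst₂ ℕ.Coprime (sym (ℤ.∣-i∣≡∣i∣ (+ u))) (sym (ℤ.∣-i∣≡∣i∣ (+ v))) u⊥v
  negate-both : ∀ i j → i * j ≡ - i * - j
  negate-both = solve-∀
  c≡-u*-v : + c ≡ - + u * - + v
  c≡-u*-v = trans (pos-factors u v c≡uv) (negate-both (+ u) (+ v))
  2∣-u : + 2 ∣ - + u
  2∣-u = subst (2 ℕ.∣_) (sym (ℤ.∣-i∣≡∣i∣ (+ u))) 2∣u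
  square-u′ : HalfSumSquare A S → IsSquare (- (- + u))
  square-u′ half = subst IsSquare (sym (ℤ.neg-involutive (+ u))) (square-pos (square-u half))
  rearrange : ∀ p q → + 4 * - p - - q ≡ q - + 4 * p
  rearrange = solve-∀
  difference : + 4 * (- + v) ^ N - (- + u) ^ N ≡ + 4 * a (suc m) (- + u * - + v)
  difference = begin
    + 4 * (- + v) ^ N - (- + u) ^ N          ≡⟨ cong₂ (λ p q → + 4 * p - q) (neg-^-odd (+ v) K) (neg-^-odd (+ u) K) ⟩
    + 4 * - ((+ v) ^ N) - - ((+ u) ^ N)      ≡⟨ cong₂ (λ p q → + 4 * - p - - q) (pos-^ v N) (pos-^ u N) ⟩
    + 4 * - + (v ℕ.^ N) - - + (u ℕ.^ N)      ≡⟨ rearrange (+ (v ℕ.^ N)) (+ (u ℕ.^ N)) ⟩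
    + (u ℕ.^ N) - + 4 * + (v ℕ.^ N)          ≡⟨ cong (λ p → + (u ℕ.^ N) - p) (ℤ.pos-* 4 (v ℕ.^ N)) ⟨
    + (u ℕ.^ N) - + (4 ℕ.* v ℕ.^ N)          ≡⟨ pos-minus (4 ℕ.* v ℕ.^ N) uᴺ≡4vᴺ+4A ⟩
    + (4 ℕ.* A)                              ≡⟨ ℤ.pos-* 4 A ⟩
    + 4 * + A                                ≡⟨ cong (+ 4 *_) (a-at-factors (suc m) (- + u) (- + v) c≡-u*-v aₘ≡A) ⟩
    + 4 * a (suc m) (- + u * - + v)          ∎

lemma4p1 : (c n : ℕ) → 1 ℕ.≤ c → 2 ℕ.≤ n → IsSquare (a n (+ c)) →
    ∃[ u ] ∃[ v ] (Coprime u v × + c ≡ u * v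
      × (¬ (+ 2 ∣ + c) → v ^ (2 ℕ.^ (n ℕ.∸ 1) ℕ.∸ 1) - u ^ (2 ℕ.^ (n ℕ.∸ 1) ℕ.∸ 1) ≡ + 2 * a (n ℕ.∸ 1) (u * v))
      × (+ 2 ∣ + c → (+ 2 ∣ u) × (+ 4 * v ^ (2 ℕ.^ (n ℕ.∸ 1) ℕ.∸ 1) - u ^ (2 ℕ.^ (n ℕ.∸ 1) ℕ.∸ 1) ≡ + 4 * a (n ℕ.∸ 1) (u * v)))
      × ((s : ℤ) → + 0 ≤ s → s * s ≡ a n (+ c) → (∃[ t ] (a (n ℕ.∸ 1) (+ c) + s ≡ + 2 * (t * t))) →
        (+ 2 ∣ + c) × ((IsSquare v × + 0 < u × + 0 < v) ⊎ (IsSquare (- u) × u < + 0 × v < + 0))))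
lemma4p1 zero      _             ()  _              _
lemma4p1 (suc _)   zero          _   ()             _
lemma4p1 (suc _)   (suc zero)    _   (ℕ.s≤s ())     _
lemma4p1 c@(suc _) (suc (suc m)) _   _              (s₀ , s₀s₀≡aₙ) with odd-exponent m
... | K , 2^[m+1]∸1≡N = subst (Conclusion c m) (sym 2^[m+1]∸1≡N)
  (conclude K {m = m} {S = S} _ aₘ≡A aₙ≡SS (factorise {S = S} K (aℕ-coprime m c) SS≡A²+cᴺ))
  where
  open ≡-Reasoning
  A S : ℕ
  A = aℕ (suc m) c
  S = ∣ s₀ ∣
  aₘ≡A : a (suc m) (+ c) ≡ + A
  aₘ≡A = a-pos (suc m) c
  aₙ≡SS : a (suc (suc m)) (+ c) ≡ + (S ℕ.* S)
  aₙ≡SS = trans (sym s₀s₀≡aₙ) (square-abs s₀)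
  SS≡A²+cᴺ : S ℕ.* S ≡ A ℕ.* A ℕ.+ c ℕ.^ suc (K ℕ.+ K)
  SS≡A²+cᴺ = begin
    S ℕ.* S                                ≡⟨ ℤ.+-injective (trans (sym aₙ≡SS) (a-pos (suc (suc m)) c)) ⟩
    A ℕ.^ 2 ℕ.+ c ℕ.^ (2 ℕ.^ suc m ℕ.∸ 1)  ≡⟨ cong₂ ℕ._+_ (cong (A ℕ.*_) (ℕ.*-identityʳ A)) (cong (c ℕ.^_) 2^[m+1]∸1≡N) ⟩
    A ℕ.* A ℕ.+ c ℕ.^ suc (K ℕ.+ K)        ∎
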